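{- Let $A$ and $B$ be skew shapes and let $k,l\ge1$. Then $\mathrm{rows}_k(A)\trianglelefteq\mathrm{rows}_k(B)$ if and only if $R_{k,l'}(A)\le R_{k,l'}(B)$ for all $l'\ge1$. Similarly, $\mathrm{cols}_l(A)\trianglelefteq\mathrm{cols}_l(B)$ if and only if $R_{k',l}(A)\le R_{k',l}(B)$ for all $k'\ge1$. Consequently, the following are equivalent: (i) $\mathrm{rows}_k(A)\trianglelefteq\mathrm{rows}_k(B)$ for all $k$; (ii) $\mathrm{cols}_l(A)\trianglelefteq\mathrm{cols}_l(B)$ for all $l$; (iii) $R_{k,l}(A)\le R_{k,l}(B)$ for all $k,l$.
   Context: A skew shape $\lambda/\mu$ is the set of boxes of the Young diagram of $\lambda$ (English notation) not in that of $\mu\subseteq\lambda$. For a skew shape $A$ with $r$ rows (numbered $1,\ldots,r$ from top to bottom) and $k\ge1$, for $i=1,\ldots,r-k+1$ let $\mathrm{ov}_k(i)$ be the number of columns occupied in common by rows $i,i+1,\ldots,i+k-1$ of $A$; $\mathrm{rows}_k(A)$ is the partition obtained by sorting $(\mathrm{ov}_k(1),\ldots,\mathrm{ov}_k(r-k+1))$ into weakly decreasing order (zeros discarded; it is the empty partition if $k>r$). $\mathrm{cols}_l(A)$ is defined analogously using overlaps among $l$ consecutive columns (number of rows occupied in common). $R_{k,l}(A)$ is the number of $k\times l$ rectangular subdiagrams (sets of boxes occupying $k$ consecutive rows and $l$ consecutive columns) contained in $A$. For partitions $\lambda=(\lambda_1,\ldots,\lambda_r)$, $\mu$ (with trailing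 zeros), $\lambda\trianglelefteq\mu$ means $\lambda_1+\cdots+\lambda_j\le\mu_1+\cdots+\mu_j$ for all $j=1,\ldots,r$; sizes need not be equal. -}

module Defs where

open import Data.Nat using (ℕ; zero; suc; _+_; _∸_; _≤_; _≤ᵇ_; _<ᵇ_)
open import Data.Nat.Properties using (≤-decTotalOrder)
open import Data.Bool using (Bool; true; false; _∧_; if_then_else_)
open import Data.List using (List; []; _∷_; length; filter; map; take; upTo)
open import Data.Nat.ListAction using (sum)
open import Relation.Binary.Properties.DecTotalOrder ≤-decTotalOrder using (≥-decTotalOrder)
open import Data.List.Sort.MergeSort ≥-decTotalOrder using (sort)
open import Relation.Nullary.Decidable using (¬?)
open import Data.Nat using (_≟_)

-- p_i of a partition written as a finite list, with trailing zeros (0-indexed)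
part : List ℕ → ℕ → ℕ
part []       _       = 0
part (x ∷ _)  zero    = x
part (_ ∷ xs) (suc i) = part xs i

IsPartition : List ℕ → Set
IsPartition p = ∀ i → part p (suc i) ≤ part p i

record SkewShape : Set where
  field
    outer      : List ℕ
    inner      : List ℕ
    outer-part : IsPartition outer
    inner-part : IsPartition inner
    inner⊆outer : ∀ i → part inner i ≤ part outer i
open SkewShape public

-- number of rows r (rows of λ, numbered 0..r-1 top to bottom)
nrows : SkewShape → ℕ
nrows A = length (outer A)

ncols : SkewShape → ℕ
ncols A = part (outer A) 0

-- box (i , c) (row i, column c, 0-indexed) lies in A
inA : SkewShape → ℕ → ℕ → Bool
inA A i c = (part (inner A) i ≤ᵇ c) ∧ (c <ᵇ part (outer A) i)

allBelow : ℕ → (ℕ → Bool) → Bool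
allBelow zero    P = true
allBelow (suc n) P = allBelow n P ∧ P n

count : ℕ → (ℕ → Bool) → ℕ
count zero    P = 0
count (suc n) P = count n P + (if P n then 1 else 0)

ovRows : SkewShape → ℕ → ℕ → ℕ
ovRows A k i = count (ncols A) (λ c → allBelow k (λ j → inA A (i + j) c))

ovCols : SkewShape → ℕ → ℕ → ℕ
ovCols A l c = count (nrows A) (λ i → allBelow l (λ j → inA A i (c + j)))

toPartition : List ℕ → List ℕ
toPartition xs = sort (filter (λ x → ¬? (x ≟ 0)) xs)

-- rows_k(A): windows i = 0 .. r-k  (empty when k > r)
rowsK : ℕ → SkewShape → List ℕ
rowsK k A = toPartition (map (ovRows A k) (upTo (suc (nrows A) ∸ k)))

-- cols_l(A): windows c = 0 .. (#columns)-l
colsL : ℕ → SkewShape → List ℕ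
colsL l A = toPartition (map (ovCols A l) (upTo (suc (ncols A) ∸ l)))

-- dominance order (sizes need not agree)
_⊴_ : List ℕ → List ℕ → Set
p ⊴ q = ∀ j → sum (take j p) ≤ sum (take j q)

sumTo : ℕ → (ℕ → ℕ) → ℕ
sumTo zero    f = 0
sumTo (suc n) f = sumTo n f + f n

rectIn : ℕ → ℕ → SkewShape → ℕ → ℕ → Bool
rectIn k l A i c = allBelow k (λ a → allBelow l (λ b → inA A (i + a) (c + b)))

-- R_{k,l}(A): number of k×l rectangles (k consecutive rows, l consecutive columns) in A
-- (every box of A has row < nrows A and column < ncols A)
R : ℕ → ℕ → SkewShape → ℕ
R k l A = sumTo (nrows A) (λ i → count (ncols A) (rectIn k l A i))

module Submission where

-- Every row of a skew shape is an interval of columns, so the columns common to k consecutive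
-- rows form an interval too; if its length is L, a k × (t + 1) rectangle on those rows is fixed by
-- its first column, which has L ∸ t possible positions.  Hence R_{k,t+1}(A) = Σ_i (ov_k(i) ∸ t)
-- depends only on the multiset rows_k(A).  Since λ and μ are partitions, every column is an
-- interval of rows as well, and counting rectangles column by column gives the same formula for
-- R_{k+1,l}(A) in terms of cols_l(A).  Finally, for weakly decreasing p and q, p ⊴ q iff
-- Σ_i (p_i ∸ t) ≤ Σ_i (q_i ∸ t) for all t, because p_1 + ⋯ + p_j = min_t (Σ_i (p_i ∸ t) + j t),
-- attained at t = p_{j+1}, and Σ_i (p_i ∸ t) = max_m (p_1 + ⋯ + p_m − m t).

open import Defs
open import Data.Nat hiding (_≟_)
open import Data.Nat.Properties
open import Algebra.Properties.CommutativeSemigroup +-commutativeSemigroup using (interchange)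
open import Data.Bool using (Bool; true; false; _∧_; T; if_then_else_)
open import Data.Bool.Properties using (T-∧; T-≡; ∧-zeroʳ)
open import Data.Empty using (⊥-elim)
open import Data.Unit using (tt)
open import Data.Sum using (inj₁; inj₂)
open import Data.Product using (Σ-syntax; _×_; _,_; proj₁; proj₂)
open import Data.List using (List; []; _∷_; _∷ʳ_; length; map; take; filter; upTo)
open import Data.List.Properties using (upTo-∷ʳ; map-++; map-∘)
open import Data.Nat.ListAction using (sum)
open import Data.Nat.ListAction.Properties using (sum-++; sum-↭)
open import Data.List.Relation.Unary.All as All using (All; []; _∷_)
open import Data.List.Relation.Unary.Linked as Linked using (Linked)
open import Data.List.Relation.Unary.Linked.Properties using (Linked⇒All)
import Data.List.Relation.Binary.Permutation.Propositional.Properties as Perm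
open import Relation.Binary.Properties.DecTotalOrder ≤-decTotalOrder using (≥-decTotalOrder)
open import Data.List.Sort.MergeSort.Properties ≥-decTotalOrder using (sort-↭; sort-↗)
open import Function using (_∘_)
open import Function.Bundles using (_⇔_; mk⇔; Equivalence)
open import Relation.Binary.PropositionalEquality
open import Relation.Nullary using (¬_; yes; no)
open import Relation.Nullary.Decidable using (¬?)
open Equivalence

excess : List ℕ → ℕ → ℕ
excess xs t = sum (map (_∸ t) xs)

excess-≡0 : ∀ {t} xs → All (_≤ t) xs → excess xs t ≡ 0
excess-≡0 []       []         = refl
excess-≡0 (x ∷ xs) (x≤t ∷ ps) = cong₂ _+_ (m≤n⇒m∸n≡0 x≤t) (excess-≡0 xs ps)

excess-∷+* : ∀ {x t} xs m → t ≤ x →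
  excess (x ∷ xs) t + suc m * t ≡ x + (excess xs t + m * t)
excess-∷+* {x} {t} xs m t≤x = begin
  (x ∸ t + excess xs t) + (t + m * t) ≡⟨ interchange (x ∸ t) (excess xs t) t (m * t) ⟩
  (x ∸ t + t) + (excess xs t + m * t) ≡⟨ cong (_+ (excess xs t + m * t)) (m∸n+n≡m t≤x) ⟩
  x + (excess xs t + m * t)           ∎
  where open ≡-Reasoning

sum-take≤excess+* : ∀ j xs t → sum (take j xs) ≤ excess xs t + j * t
sum-take≤excess+* zero    xs       t = z≤n
sum-take≤excess+* (suc j) []       t = z≤n
sum-take≤excess+* (suc j) (x ∷ xs) t = begin
  x + sum (take j xs)                   ≤⟨ +-mono-≤ (m≤n+m∸n x t) (sum-take≤excess+* j xs t) ⟩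
  (t + (x ∸ t)) + (excess xs t + j * t) ≡⟨ cong (_+ (excess xs t + j * t)) (+-comm t (x ∸ t)) ⟩
  (x ∸ t + t) + (excess xs t + j * t)   ≡⟨ interchange (x ∸ t) t (excess xs t) (j * t) ⟩
  excess (x ∷ xs) t + suc j * t         ∎
  where open ≤-Reasoning

Decreasing : List ℕ → Set
Decreasing = Linked _≥_

decreasing⇒≤head : ∀ {x xs} → Decreasing (x ∷ xs) → All (_≤ x) (x ∷ xs)
decreasing⇒≤head = Linked⇒All (λ y≤x z≤y → ≤-trans z≤y y≤x) ≤-refl

All≤⇒part≤ : ∀ {x} xs j → All (_≤ x) xs → part xs j ≤ x
All≤⇒part≤ []       j       []       = z≤n
All≤⇒part≤ (y ∷ ys) zero    (p ∷ _)  = p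
All≤⇒part≤ (y ∷ ys) (suc j) (_ ∷ ps) = All≤⇒part≤ ys j ps

excess-part+*≤sum-take : ∀ j q → Decreasing q →
  excess q (part q j) + j * part q j ≤ sum (take j q)
excess-part+*≤sum-take zero    []       _ = z≤n
excess-part+*≤sum-take (suc j) []       _ = ≤-reflexive (*-zeroʳ (suc j))
excess-part+*≤sum-take zero    (x ∷ xs) d =
  ≤-reflexive (trans (+-identityʳ _) (excess-≡0 (x ∷ xs) (decreasing⇒≤head d)))
excess-part+*≤sum-take (suc j) (x ∷ xs) d with decreasing⇒≤head d
... | _ ∷ xs≤x = begin
  excess (x ∷ xs) t + suc j * t ≡⟨ excess-∷+* xs j (All≤⇒part≤ xs j xs≤x) ⟩
  x + (excess xs t + j * t)     ≤⟨ +-monoʳ-≤ x (excess-part+*≤sum-take j xs (Linked.tail d)) ⟩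
  x + sum (take j xs)           ∎
  where open ≤-Reasoning
        t = part xs j

∃-excess+*≤sum-take : ∀ p t → Decreasing p → Σ[ m ∈ ℕ ] excess p t + m * t ≤ sum (take m p)
∃-excess+*≤sum-take []       t _ = 0 , z≤n
∃-excess+*≤sum-take (x ∷ xs) t d with t ≤? x
... | yes t≤x = let m , h = ∃-excess+*≤sum-take xs t (Linked.tail d) in suc m , (begin
  excess (x ∷ xs) t + suc m * t ≡⟨ excess-∷+* xs m t≤x ⟩
  x + (excess xs t + m * t)     ≤⟨ +-monoʳ-≤ x h ⟩
  x + sum (take m xs)           ∎)
  where open ≤-Reasoning
... | no  t≰x = 0 , ≤-reflexive (trans (+-identityʳ _) (excess-≡0 (x ∷ xs) all≤t))
  where
  all≤t : All (_≤ t) (x ∷ xs)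
  all≤t = All.map (λ y≤x → ≤-trans y≤x (<⇒≤ (≰⇒> t≰x))) (decreasing⇒≤head d)

⊴⇔excess≤ : ∀ {p q} → Decreasing p → Decreasing q → (p ⊴ q) ⇔ (∀ t → excess p t ≤ excess q t)
⊴⇔excess≤ {p} {q} dp dq = mk⇔ ⇒ ⇐
  where
  ⇒ : p ⊴ q → ∀ t → excess p t ≤ excess q t
  ⇒ p⊴q t = let m , h = ∃-excess+*≤sum-take p t dp in
    +-cancelʳ-≤ (m * t) _ _ (≤-trans h (≤-trans (p⊴q m) (sum-take≤excess+* m q t)))
  ⇐ : (∀ t → excess p t ≤ excess q t) → p ⊴ q
  ⇐ p≤q j = let t = part q j in
    ≤-trans (sum-take≤excess+* j p t)
      (≤-trans (+-monoˡ-≤ (j * t) (p≤q t)) (excess-part+*≤sum-take j q dq))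

excess-filter-nonzero : ∀ xs t → excess (filter (λ x → ¬? (x ≟ 0)) xs) t ≡ excess xs t
excess-filter-nonzero []           t = refl
excess-filter-nonzero (zero  ∷ xs) t = trans (excess-filter-nonzero xs t) (cong (_+ excess xs t) (sym (0∸n≡0 t)))
excess-filter-nonzero (suc x ∷ xs) t = cong (suc x ∸ t +_) (excess-filter-nonzero xs t)

excess-toPartition : ∀ xs t → excess (toPartition xs) t ≡ excess xs t
excess-toPartition xs t =
  trans (sum-↭ (Perm.map⁺ (_∸ t) (sort-↭ (filter (λ x → ¬? (x ≟ 0)) xs)))) (excess-filter-nonzero xs t)

toPartition-decreasing : ∀ xs → Decreasing (toPartition xs)
toPartition-decreasing xs = sort-↗ (filter (λ x → ¬? (x ≟ 0)) xs)

T⇔⇒≡ : ∀ {a b} → (T a ⇔ T b) → a ≡ b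
T⇔⇒≡ {false} {false} _   = refl
T⇔⇒≡ {false} {true}  a⇔b = ⊥-elim (a⇔b .from tt)
T⇔⇒≡ {true}  {false} a⇔b = ⊥-elim (a⇔b .to tt)
T⇔⇒≡ {true}  {true}  _   = refl

¬T⇒≡false : ∀ {a} → ¬ T a → a ≡ false
¬T⇒≡false ¬a = T⇔⇒≡ (mk⇔ ¬a λ ())

T-allBelow : ∀ n P → T (allBelow n P) ⇔ (∀ j → j < n → T (P j))
T-allBelow zero    P = mk⇔ (λ _ _ ()) (λ _ → tt)
T-allBelow (suc n) P = mk⇔ ⇒ ⇐
  where
  ⇒ : T (allBelow n P ∧ P n) → ∀ j → j < suc n → T (P j)
  ⇒ h j j<1+n with T-∧ .to h | m≤n⇒m<n∨m≡n (s≤s⁻¹ j<1+n)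
  ... | below , _ | inj₁ j<n  = T-allBelow n P .to below j j<n
  ... | _ , Pn    | inj₂ refl = Pn
  ⇐ : (∀ j → j < suc n → T (P j)) → T (allBelow n P ∧ P n)
  ⇐ h = T-∧ .from (T-allBelow n P .from (λ j → h j ∘ m≤n⇒m≤1+n) , h n ≤-refl)

allBelow-comm : ∀ k l (H : ℕ → ℕ → Bool) →
  allBelow k (λ a → allBelow l (H a)) ≡ allBelow l (λ b → allBelow k (λ a → H a b))
allBelow-comm k l H = T⇔⇒≡ (mk⇔ (swap k l H) (swap l k (λ b a → H a b)))
  where
  swap : ∀ k l (H : ℕ → ℕ → Bool) →
    T (allBelow k (λ a → allBelow l (H a))) → T (allBelow l (λ b → allBelow k (λ a → H a b)))
  swap k l H h = T-allBelow l _ .from λ b b<l → T-allBelow k _ .from λ a a<k →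
    T-allBelow l (H a) .to (T-allBelow k _ .to h a a<k) b b<l

sumTo-cong : ∀ n {f g : ℕ → ℕ} → (∀ i → i < n → f i ≡ g i) → sumTo n f ≡ sumTo n g
sumTo-cong zero    f≡g = refl
sumTo-cong (suc n) f≡g = cong₂ _+_ (sumTo-cong n (λ i → f≡g i ∘ m≤n⇒m≤1+n)) (f≡g n ≤-refl)

sumTo-+ : ∀ n (f g : ℕ → ℕ) → sumTo n (λ i → f i + g i) ≡ sumTo n f + sumTo n g
sumTo-+ zero    f g = refl
sumTo-+ (suc n) f g = trans (cong (_+ (f n + g n)) (sumTo-+ n f g))
  (interchange (sumTo n f) (sumTo n g) (f n) (g n))

sumTo-0 : ∀ n → sumTo n (λ _ → 0) ≡ 0
sumTo-0 zero    = refl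
sumTo-0 (suc n) = trans (+-identityʳ _) (sumTo-0 n)

sumTo-comm : ∀ m n (f : ℕ → ℕ → ℕ) →
  sumTo m (λ i → sumTo n (f i)) ≡ sumTo n (λ c → sumTo m (λ i → f i c))
sumTo-comm zero    n f = sym (sumTo-0 n)
sumTo-comm (suc m) n f = trans (cong (_+ sumTo n (f m)) (sumTo-comm m n f))
  (sym (sumTo-+ n (λ c → sumTo m (λ i → f i c)) (f m)))

sumTo-vanishing : ∀ {k n} (f : ℕ → ℕ) → (∀ i → k ≤ i → f i ≡ 0) → k ≤ n → sumTo n f ≡ sumTo k f
sumTo-vanishing {k} f f≡0 k≤n = go (≤⇒≤′ k≤n)
  where
  go : ∀ {n} → k ≤′ n → sumTo n f ≡ sumTo k f
  go ≤′-refl            = refl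
  go (≤′-step {n} k≤′n) = trans (cong₂ _+_ (go k≤′n) (f≡0 n (≤′⇒≤ k≤′n))) (+-identityʳ _)

indicator : (ℕ → Bool) → ℕ → ℕ
indicator P c = if P c then 1 else 0

count≡sumTo-indicator : ∀ n P → count n P ≡ sumTo n (indicator P)
count≡sumTo-indicator zero    P = refl
count≡sumTo-indicator (suc n) P = cong (_+ indicator P n) (count≡sumTo-indicator n P)

count-cong : ∀ n {P Q : ℕ → Bool} → (∀ c → c < n → P c ≡ Q c) → count n P ≡ count n Q
count-cong zero    P≡Q = refl
count-cong (suc n) P≡Q =
  cong₂ _+_ (count-cong n (λ c → P≡Q c ∘ m≤n⇒m≤1+n)) (cong (if_then 1 else 0) (P≡Q n ≤-refl))

count-vanishing : ∀ {k n} (P : ℕ → Bool) → (∀ c → k ≤ c → P c ≡ false) → k ≤ n →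
  count n P ≡ count k P
count-vanishing {k} {n} P P≡false k≤n = begin
  count n P             ≡⟨ count≡sumTo-indicator n P ⟩
  sumTo n (indicator P) ≡⟨ sumTo-vanishing (indicator P) (λ c → cong (if_then 1 else 0) ∘ P≡false c) k≤n ⟩
  sumTo k (indicator P) ≡⟨ count≡sumTo-indicator k P ⟨
  count k P             ∎
  where open ≡-Reasoning

sumTo-count-comm : ∀ m n (P : ℕ → ℕ → Bool) →
  sumTo m (λ i → count n (P i)) ≡ sumTo n (λ c → count m (λ i → P i c))
sumTo-count-comm m n P = begin
  sumTo m (λ i → count n (P i))
    ≡⟨ sumTo-cong m (λ i _ → count≡sumTo-indicator n (P i)) ⟩
  sumTo m (λ i → sumTo n (indicator (P i)))
    ≡⟨ sumTo-comm m n (λ i → indicator (P i)) ⟩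
  sumTo n (λ c → sumTo m (λ i → indicator (P i) c))
    ≡⟨ sumTo-cong n (λ c _ → count≡sumTo-indicator m (λ i → P i c)) ⟨
  sumTo n (λ c → count m (λ i → P i c))
    ∎
  where open ≡-Reasoning

sum-map-upTo : ∀ n f → sum (map f (upTo n)) ≡ sumTo n f
sum-map-upTo zero    f = refl
sum-map-upTo (suc n) f = begin
  sum (map f (upTo (suc n)))         ≡⟨ cong (sum ∘ map f) (upTo-∷ʳ n) ⟨
  sum (map f (upTo n ∷ʳ n))          ≡⟨ cong sum (map-++ f (upTo n) (n ∷ [])) ⟩
  sum (map f (upTo n) ∷ʳ f n)        ≡⟨ sum-++ (map f (upTo n)) (f n ∷ []) ⟩
  sum (map f (upTo n)) + (f n + 0)   ≡⟨ cong₂ _+_ (sum-map-upTo n f) (+-identityʳ (f n)) ⟩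
  sumTo n f + f n                    ∎
  where open ≡-Reasoning

Interval : (ℕ → Bool) → ℕ → ℕ → Set
Interval P lo hi = ∀ c → T (P c) ⇔ (lo ≤ c × c < hi)

IntervalBelow : ℕ → (ℕ → Bool) → Set
IntervalBelow n P = Σ[ lo ∈ ℕ ] Σ[ hi ∈ ℕ ] hi ≤ n × Interval P lo hi

count-prefix-interval : ∀ {P lo hi} → Interval P lo hi → ∀ n → n ≤ hi → count n P ≡ n ∸ lo
count-prefix-interval {lo = lo} iv zero _ = sym (0∸n≡0 lo)
count-prefix-interval {P} {lo} iv (suc n) n<hi with lo ≤? n
... | yes lo≤n = begin
  count n P + indicator P n ≡⟨ cong₂ _+_ (count-prefix-interval iv n (<⇒≤ n<hi))
                                 (cong (if_then 1 else 0) (T-≡ .to (iv n .from (lo≤n , n<hi)))) ⟩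
  n ∸ lo + 1                ≡⟨ +-comm (n ∸ lo) 1 ⟩
  suc (n ∸ lo)              ≡⟨ +-∸-assoc 1 lo≤n ⟨
  suc n ∸ lo                ∎
  where open ≡-Reasoning
... | no lo≰n = begin
  count n P + indicator P n ≡⟨ cong₂ _+_ (count-prefix-interval iv n (<⇒≤ n<hi))
                                 (cong (if_then 1 else 0) (¬T⇒≡false (lo≰n ∘ proj₁ ∘ iv n .to))) ⟩
  n ∸ lo + 0                ≡⟨ +-identityʳ _ ⟩
  n ∸ lo                    ≡⟨ m≤n⇒m∸n≡0 (<⇒≤ (≰⇒> lo≰n)) ⟩
  0                         ≡⟨ m≤n⇒m∸n≡0 (≰⇒> lo≰n) ⟨
  suc n ∸ lo                ∎
  where open ≡-Reasoning

count-interval : ∀ {P lo hi n} → Interval P lo hi → hi ≤ n → count n P ≡ hi ∸ lo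
count-interval {P} {hi = hi} iv hi≤n = trans
  (count-vanishing P (λ c hi≤c → ¬T⇒≡false (λ Pc → <⇒≱ (proj₂ (iv c .to Pc)) hi≤c)) hi≤n)
  (count-prefix-interval iv hi ≤-refl)

Interval-∧ : ∀ {P Q lo hi lo′ hi′} → Interval P lo hi → Interval Q lo′ hi′ →
  Interval (λ c → P c ∧ Q c) (lo ⊔ lo′) (hi ⊓ hi′)
Interval-∧ {P} {Q} {lo} {hi} {lo′} {hi′} iv iv′ c = mk⇔ ⇒ ⇐
  where
  ⇒ : T (P c ∧ Q c) → lo ⊔ lo′ ≤ c × c < hi ⊓ hi′
  ⇒ PQc with T-∧ .to PQc
  ... | Pc , Qc with iv c .to Pc | iv′ c .to Qc
  ...   | lo≤c , c<hi | lo′≤c , c<hi′ = ⊔-lub lo≤c lo′≤c , ⊓-glb c<hi c<hi′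
  ⇐ : lo ⊔ lo′ ≤ c × c < hi ⊓ hi′ → T (P c ∧ Q c)
  ⇐ (≤c , c<) = T-∧ .from
    ( iv  c .from (m⊔n≤o⇒m≤o lo lo′ ≤c , m<n⊓o⇒m<n hi hi′ c<)
    , iv′ c .from (m⊔n≤o⇒n≤o lo lo′ ≤c , m<n⊓o⇒m<o hi hi′ c<))

Interval-shift : ∀ {P lo hi} t → Interval P lo hi →
  Interval (λ c → allBelow (suc t) (λ b → P (c + b))) lo (hi ∸ t)
Interval-shift {P} {lo} {hi} t iv c = mk⇔ ⇒ ⇐
  where
  ⇒ : T (allBelow (suc t) (λ b → P (c + b))) → lo ≤ c × c < hi ∸ t
  ⇒ h = let all = T-allBelow (suc t) (λ b → P (c + b)) .to h in
    subst (lo ≤_) (+-identityʳ c) (proj₁ (iv (c + 0) .to (all 0 z<s))) ,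
    m+n≤o⇒m≤o∸n (suc c) (proj₂ (iv (c + t) .to (all t ≤-refl)))
  ⇐ : lo ≤ c × c < hi ∸ t → T (allBelow (suc t) (λ b → P (c + b)))
  ⇐ (lo≤c , c<hi∸t) = T-allBelow (suc t) _ .from λ b b≤t → iv (c + b) .from
    (≤-trans lo≤c (m≤m+n c b) , ≤-<-trans (+-monoʳ-≤ c (s≤s⁻¹ b≤t)) c+t<hi)
    where
    c+t<hi : c + t < hi
    c+t<hi = m≤o∸n⇒m+n≤o (suc c) (<⇒≤ (m∸n≢0⇒n<m (m<n⇒n≢0 c<hi∸t))) c<hi∸t

module RectangleCount (G : ℕ → ℕ → Bool) (m n : ℕ)
  (row-interval : ∀ i → IntervalBelow n (G i))
  (row-empty : ∀ i c → m ≤ i → G i c ≡ false) where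

  -- For G = inA X, ov and rect are ovRows X and rectIn X verbatim; for its transpose, ov is ovCols X.
  window : ℕ → ℕ → ℕ → Bool
  window k i c = allBelow k (λ a → G (i + a) c)

  ov : ℕ → ℕ → ℕ
  ov k i = count n (window k i)

  rect : ℕ → ℕ → ℕ → ℕ → Bool
  rect k l i c = allBelow k (λ a → allBelow l (λ b → G (i + a) (c + b)))

  window-interval : ∀ k i → IntervalBelow n (window (suc k) i)
  window-interval zero    i = row-interval (i + 0)
  window-interval (suc k) i with window-interval k i | row-interval (i + suc k)
  ... | lo , hi , hi≤n , iv | lo′ , hi′ , _ , iv′ =
    lo ⊔ lo′ , hi ⊓ hi′ , ≤-trans (m⊓n≤m hi hi′) hi≤n , Interval-∧ iv iv′

  count-rect : ∀ k t i → count n (rect (suc k) (suc t) i) ≡ ov (suc k) i ∸ t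
  count-rect k t i with window-interval k i
  ... | lo , hi , hi≤n , iv = begin
    count n (rect (suc k) (suc t) i)
      ≡⟨ count-cong n (λ c _ → allBelow-comm (suc k) (suc t) (λ a b → G (i + a) (c + b))) ⟩
    count n (λ c → allBelow (suc t) (λ b → window (suc k) i (c + b)))
      ≡⟨ count-interval (Interval-shift t iv) (≤-trans (m∸n≤m hi t) hi≤n) ⟩
    hi ∸ t ∸ lo   ≡⟨ ∸-+-assoc hi t lo ⟩
    hi ∸ (t + lo) ≡⟨ cong (hi ∸_) (+-comm t lo) ⟩
    hi ∸ (lo + t) ≡⟨ ∸-+-assoc hi lo t ⟨
    hi ∸ lo ∸ t   ≡⟨ cong (_∸ t) (count-interval iv hi≤n) ⟨
    ov (suc k) i ∸ t ∎
    where open ≡-Reasoning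

  ov-beyond : ∀ k i → m ≤ i + k → ov (suc k) i ≡ 0
  ov-beyond k i m≤i+k = count-vanishing {n = n} (window (suc k) i)
    (λ c _ → trans (cong (window k i c ∧_) (row-empty (i + k) c m≤i+k)) (∧-zeroʳ _)) z≤n

  sum-count-rect : ∀ k t →
    sumTo m (λ i → count n (rect (suc k) (suc t) i))
      ≡ excess (toPartition (map (ov (suc k)) (upTo (m ∸ k)))) t
  sum-count-rect k t = begin
    sumTo m (λ i → count n (rect (suc k) (suc t) i))
      ≡⟨ sumTo-cong m (λ i _ → count-rect k t i) ⟩
    sumTo m (λ i → ov (suc k) i ∸ t)
      ≡⟨ sumTo-vanishing (λ i → ov (suc k) i ∸ t) vanishing (m∸n≤m m k) ⟩
    sumTo (m ∸ k) (λ i → ov (suc k) i ∸ t)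
      ≡⟨ sum-map-upTo (m ∸ k) _ ⟨
    sum (map ((_∸ t) ∘ ov (suc k)) (upTo (m ∸ k)))
      ≡⟨ cong sum (map-∘ (upTo (m ∸ k))) ⟩
    excess (map (ov (suc k)) (upTo (m ∸ k))) t
      ≡⟨ excess-toPartition (map (ov (suc k)) (upTo (m ∸ k))) t ⟨
    excess (toPartition (map (ov (suc k)) (upTo (m ∸ k)))) t ∎
    where
    open ≡-Reasoning
    vanishing : ∀ i → m ∸ k ≤ i → ov (suc k) i ∸ t ≡ 0
    vanishing i m∸k≤i = trans (cong (_∸ t) (ov-beyond k i m≤i+k)) (0∸n≡0 t)
      where
      m≤i+k : m ≤ i + k
      m≤i+k = ≤-trans (m≤n+m∸n m k) (≤-trans (+-monoʳ-≤ k m∸k≤i) (≤-reflexive (+-comm k i)))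

antitone-≤ : ∀ {f : ℕ → ℕ} → (∀ i → f (suc i) ≤ f i) → ∀ {i j} → i ≤ j → f j ≤ f i
antitone-≤ {f} f↓ {i} i≤j = go (≤⇒≤′ i≤j)
  where
  go : ∀ {j} → i ≤′ j → f j ≤ f i
  go ≤′-refl         = ≤-refl
  go (≤′-step i≤′j) = ≤-trans (f↓ _) (go i≤′j)

antitone-sublevel : ∀ {f : ℕ → ℕ} → (∀ i → f (suc i) ≤ f i) → ∀ {c} r → f r ≤ c →
  Σ[ lo ∈ ℕ ] lo ≤ r × (∀ i → f i ≤ c ⇔ lo ≤ i)
antitone-sublevel {f} f↓ {c} zero fr≤c =
  0 , z≤n , λ i → mk⇔ (λ _ → z≤n) (λ _ → ≤-trans (antitone-≤ f↓ z≤n) fr≤c)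
antitone-sublevel {f} f↓ {c} (suc r) fr≤c with f r ≤? c
... | yes fr′≤c = let lo , lo≤r , iv = antitone-sublevel f↓ r fr′≤c in
  lo , m≤n⇒m≤1+n lo≤r , iv
... | no  fr′≰c = suc r , ≤-refl , λ i → mk⇔
  (λ fi≤c → ≰⇒> (λ i≤r → fr′≰c (≤-trans (antitone-≤ f↓ i≤r) fi≤c)))
  (λ r<i → ≤-trans (antitone-≤ f↓ r<i) fr≤c)

part-beyond : ∀ xs {i} → length xs ≤ i → part xs i ≡ 0
part-beyond []       _ = refl
part-beyond (x ∷ xs) {suc i} (s≤s le) = part-beyond xs le

module _ (X : SkewShape) where

  inA⇔ : ∀ {i c} → T (inA X i c) ⇔ (part (inner X) i ≤ c × c < part (outer X) i)
  inA⇔ {i} {c} = mk⇔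
    (λ h → let μ≤c , c<λ = T-∧ .to h in ≤ᵇ⇒≤ _ _ μ≤c , <ᵇ⇒< _ _ c<λ)
    (λ (μ≤c , c<λ) → T-∧ .from (≤⇒≤ᵇ μ≤c , <⇒<ᵇ c<λ))

  inner-beyond : ∀ {i} → nrows X ≤ i → part (inner X) i ≡ 0
  inner-beyond {i} r≤i =
    n≤0⇒n≡0 (subst (part (inner X) i ≤_) (part-beyond (outer X) r≤i) (inner⊆outer X i))

  row-interval : ∀ i → IntervalBelow (ncols X) (inA X i)
  row-interval i =
    part (inner X) i , part (outer X) i , antitone-≤ (outer-part X) z≤n , λ _ → inA⇔

  row-empty : ∀ i c → nrows X ≤ i → inA X i c ≡ false
  row-empty i c r≤i = ¬T⇒≡false λ h →
    n≮0 (subst (c <_) (part-beyond (outer X) r≤i) (proj₂ (inA⇔ .to h)))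

  column-interval : ∀ c → IntervalBelow (nrows X) (λ i → inA X i c)
  column-interval c
    with antitone-sublevel (inner-part X) (nrows X) (≤-trans (≤-reflexive (inner-beyond ≤-refl)) (z≤n {c}))
       | antitone-sublevel (outer-part X) (nrows X) (≤-trans (≤-reflexive (part-beyond (outer X) ≤-refl)) (z≤n {c}))
  ... | lo , _ , μ≤c⇔ | hi , hi≤r , λ≤c⇔ = lo , hi , hi≤r , λ i → mk⇔
    (λ h → let μ≤c , c<λ = inA⇔ .to h in
      μ≤c⇔ i .to μ≤c , ≰⇒> (λ hi≤i → <⇒≱ c<λ (λ≤c⇔ i .from hi≤i)))
    (λ (lo≤i , i<hi) → inA⇔ .from
      (μ≤c⇔ i .from lo≤i , ≰⇒> (λ λ≤c → <⇒≱ i<hi (λ≤c⇔ i .to λ≤c))))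

  column-empty : ∀ c i → ncols X ≤ c → inA X i c ≡ false
  column-empty c i N≤c = ¬T⇒≡false λ h →
    <⇒≱ (proj₂ (inA⇔ .to h)) (≤-trans (antitone-≤ (outer-part X) z≤n) N≤c)

R≡excess-rowsK : ∀ X k t → R (suc k) (suc t) X ≡ excess (rowsK (suc k) X) t
R≡excess-rowsK X =
  RectangleCount.sum-count-rect (inA X) (nrows X) (ncols X) (row-interval X) (row-empty X)

R≡excess-colsL : ∀ X k t → R (suc k) (suc t) X ≡ excess (colsL (suc t) X) k
R≡excess-colsL X k t = begin
  R (suc k) (suc t) X
    ≡⟨ sumTo-count-comm (nrows X) (ncols X) (rectIn (suc k) (suc t) X) ⟩
  sumTo (ncols X) (λ c → count (nrows X) (λ i → rectIn (suc k) (suc t) X i c))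
    ≡⟨ sumTo-cong (ncols X) (λ c _ → count-cong (nrows X) (λ i _ →
         allBelow-comm (suc k) (suc t) (λ a b → inA X (i + a) (c + b)))) ⟩
  sumTo (ncols X) (λ c → count (nrows X) (rect (suc t) (suc k) c))
    ≡⟨ sum-count-rect t k ⟩
  excess (colsL (suc t) X) k ∎
  where
  open ≡-Reasoning
  open RectangleCount (λ c i → inA X i c) (ncols X) (nrows X) (column-interval X) (column-empty X)

⊴⇔excess≤-shifted : ∀ {p q} (f g : ℕ → ℕ) → Decreasing p → Decreasing q →
  (∀ t → f (suc t) ≡ excess p t) → (∀ t → g (suc t) ≡ excess q t) →
  (p ⊴ q) ⇔ (∀ l → 1 ≤ l → f l ≤ g l)
⊴⇔excess≤-shifted f g dp dq f≡ g≡ = mk⇔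
  (λ p⊴q → λ { (suc t) _ → subst₂ _≤_ (sym (f≡ t)) (sym (g≡ t)) (⊴⇔excess≤ dp dq .to p⊴q t) })
  (λ f≤g → ⊴⇔excess≤ dp dq .from λ t → subst₂ _≤_ (f≡ t) (g≡ t) (f≤g (suc t) (s≤s z≤n)))

rowsK-decreasing : ∀ k X → Decreasing (rowsK k X)
rowsK-decreasing k X = toPartition-decreasing (map (ovRows X k) (upTo (suc (nrows X) ∸ k)))

colsL-decreasing : ∀ l X → Decreasing (colsL l X)
colsL-decreasing l X = toPartition-decreasing (map (ovCols X l) (upTo (suc (ncols X) ∸ l)))

rowsK⊴⇔R≤ : ∀ A B {k} → 1 ≤ k → (rowsK k A ⊴ rowsK k B) ⇔ (∀ l → 1 ≤ l → R k l A ≤ R k l B)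
rowsK⊴⇔R≤ A B {suc k} _ =
  ⊴⇔excess≤-shifted _ _ (rowsK-decreasing (suc k) A) (rowsK-decreasing (suc k) B)
    (R≡excess-rowsK A k) (R≡excess-rowsK B k)

colsL⊴⇔R≤ : ∀ A B {l} → 1 ≤ l → (colsL l A ⊴ colsL l B) ⇔ (∀ k → 1 ≤ k → R k l A ≤ R k l B)
colsL⊴⇔R≤ A B {suc l} _ =
  ⊴⇔excess≤-shifted _ _ (colsL-decreasing (suc l) A) (colsL-decreasing (suc l) B)
    (λ k → R≡excess-colsL A k l) (λ k → R≡excess-colsL B k l)

proposition3p6 : (A B : SkewShape) →
    (∀ k l → 1 ≤ k → 1 ≤ l →
      ((rowsK k A ⊴ rowsK k B) ⇔ (∀ l′ → 1 ≤ l′ → R k l′ A ≤ R k l′ B))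
      × ((colsL l A ⊴ colsL l B) ⇔ (∀ k′ → 1 ≤ k′ → R k′ l A ≤ R k′ l B)))
    × ((∀ k → 1 ≤ k → rowsK k A ⊴ rowsK k B) ⇔ (∀ l → 1 ≤ l → colsL l A ⊴ colsL l B))
    × ((∀ l → 1 ≤ l → colsL l A ⊴ colsL l B) ⇔ (∀ k l → 1 ≤ k → 1 ≤ l → R k l A ≤ R k l B))
proposition3p6 A B =
  (λ k l 1≤k 1≤l → rowsK⊴⇔R≤ A B 1≤k , colsL⊴⇔R≤ A B 1≤l) ,
  mk⇔ (R≤⇒cols ∘ rows⇒R≤) (R≤⇒rows ∘ cols⇒R≤) ,
  mk⇔ cols⇒R≤ R≤⇒cols
  where
  AllR≤ : Set
  AllR≤ = ∀ k l → 1 ≤ k → 1 ≤ l → R k l A ≤ R k l B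
  rows⇒R≤ : (∀ k → 1 ≤ k → rowsK k A ⊴ rowsK k B) → AllR≤
  rows⇒R≤ h k l 1≤k = rowsK⊴⇔R≤ A B 1≤k .to (h k 1≤k) l
  R≤⇒rows : AllR≤ → ∀ k → 1 ≤ k → rowsK k A ⊴ rowsK k B
  R≤⇒rows h k 1≤k = rowsK⊴⇔R≤ A B 1≤k .from (λ l → h k l 1≤k)
  cols⇒R≤ : (∀ l → 1 ≤ l → colsL l A ⊴ colsL l B) → AllR≤
  cols⇒R≤ h k l 1≤k 1≤l = colsL⊴⇔R≤ A B 1≤l .to (h l 1≤l) k 1≤k
  R≤⇒cols : AllR≤ → ∀ l → 1 ≤ l → colsL l A ⊴ colsL l B
  R≤⇒cols h l 1≤l = colsL⊴⇔R≤ A B 1≤l .from (λ k 1≤k → h k l 1≤k 1≤l)
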